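{- For every integer $n\ge4$ there exists a real number $\alpha>0$ that is an infinite loop mod $n$.
   Context: For $\alpha>0$ with continued fraction expansion $[a_0;a_1,a_2,\ldots]$, the convergent denominators are $q_{ -1}=0$, $q_0=1$, $q_k=a_kq_{k-1}+q_{k-2}$, and the semi-convergent denominators are $q_{\{k,m\}}=mq_k+q_{k-1}$ for $k\ge0$ and integers $0\le m\le a_{k+1}$ (if $\alpha$ is rational with finite expansion $[a_0;\ldots,a_N]$, one regards $a_{N+1}=\infty$, so all integers $m\ge0$ are allowed at $k=N$). A real number $\alpha>0$ is an infinite loop mod $n$ if none of its semi-convergent denominators is divisible by $n$, apart from $q_{ -1}=0$. -}

module Defs where

open import Data.Nat using (ℕ; zero; suc; _+_; _*_; _≤_; _<_)
open import Data.Nat.Divisibility using (_∣_)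
open import Data.Product using (_×_; _,_; proj₁; proj₂)
open import Data.Sum using (_⊎_)
open import Relation.Binary.PropositionalEquality using (_≡_)
open import Relation.Nullary using (¬_)

-- A real number α > 0 is represented by its (canonical) regular continued
-- fraction expansion [a₀; a₁, a₂, …]  (the map is a bijection onto (0,∞)).
--  * irrational α : infinite expansion, a₀ ≥ 0, aₖ ≥ 1 for k ≥ 1;
--  * rational α   : finite expansion [a₀; …, a_N] with aₖ ≥ 1 for 1 ≤ k ≤ N,
--                   a_N ≥ 2 if N ≥ 1 (canonical form), and a₀ ≥ 1 if N = 0
--                   (so that α > 0).  Values a k for k > N are ignored.
data PosReal : Set where
  irrational : (a : ℕ → ℕ) → (∀ k → 1 ≤ a (suc k)) → PosReal
  rational   : (N : ℕ) (a : ℕ → ℕ) →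
               (∀ k → 1 ≤ k → k ≤ N → 1 ≤ a k) →
               (N ≡ 0 → 1 ≤ a 0) →
               (1 ≤ N → 2 ≤ a N) → PosReal

pq : PosReal → ℕ → ℕ
pq (irrational a _)       = a
pq (rational _ a _ _ _)   = a

-- qPair a k = (q_{k-1} , q_k), with q_{-1} = 0, q_0 = 1,
-- q_k = a_k q_{k-1} + q_{k-2}.
qPair : (ℕ → ℕ) → ℕ → ℕ × ℕ
qPair a zero    = 0 , 1
qPair a (suc k) = proj₂ (qPair a k) , a (suc k) * proj₂ (qPair a k) + proj₁ (qPair a k)

q : PosReal → ℕ → ℕ
q α k = proj₂ (qPair (pq α) k)

qPrev : PosReal → ℕ → ℕ
qPrev α k = proj₁ (qPair (pq α) k)

-- (k , m) indexes a semi-convergent denominator q_{k,m} = m q_k + q_{k-1}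
-- of α: k ≥ 0 and 0 ≤ m ≤ a_{k+1}; in the rational case k ≤ N, and for k = N
-- every m ≥ 0 is allowed (a_{N+1} = ∞).
SemiIndex : PosReal → ℕ → ℕ → Set
SemiIndex (irrational a _)     k m = m ≤ a (suc k)
SemiIndex (rational N a _ _ _) k m = (k < N × m ≤ a (suc k)) ⊎ k ≡ N

semiDen : PosReal → ℕ → ℕ → ℕ
semiDen α k m = m * q α k + qPrev α k

-- α is an infinite loop mod n: no semi-convergent denominator is divisible
-- by n, apart from q_{-1} = 0 = q_{0,0}.
InfiniteLoop : ℕ → PosReal → Set
InfiniteLoop n α = ∀ k m → SemiIndex α k m → ¬ (k ≡ 0 × m ≡ 0) → ¬ (n ∣ semiDen α k m)

{-# OPTIONS --safe #-}
module Submission where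

-- For n ≥ 5 take α = [0; n − 2, 1, n − 4, 1, n − 4, …]. Modulo n its
-- convergent denominators q₀, q₁, q₂, … run through 1, −2, −1, 2 periodically.
-- Where the next partial quotient is 1 the semi-convergents are just two
-- consecutive convergents; where it is n − 4 they are ±(2 + m) with
-- 0 ≤ m ≤ n − 4. None of these residues is 0.
-- For n = 4, or any n with a divisor 1 < d < n, the rational α = [d; d]
-- works: its semi-convergent denominators are 1, …, d and m d + 1 ≡ 1 (mod d).

open import Defs
open import Data.Nat using (ℕ; zero; suc; _+_; _*_; _≤_; _<_; z≤n; s≤s)
open import Data.Nat.Properties using (≤-refl; ≤-trans; ≤-<-trans; <⇒≱; m≤n+m; m≤n⇒m≤1+n; n≤1+n; m≤n⇒∃[o]m+o≡n)
open import Data.Nat.Divisibility using (_∣_; divides; ∣⇒≤; ∣-trans; ∣m+n∣m⇒∣n; n∣m*n; ∣n⇒∣m*n)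
open import Data.Nat.Tactic.RingSolver using (solve)
open import Data.List using (_∷_; [])
open import Data.Product using (Σ; ∃-syntax; _×_; _,_)
open import Data.Sum using (inj₁; inj₂)
open import Relation.Binary.PropositionalEquality using (_≡_; refl; subst)
open import Relation.Nullary using (¬_; contradiction)

-- The quotient is explicit, so v ≤ x; in exchange congruences compose
-- without any subtraction.
infix 4 _≡_[mod_]
_≡_[mod_] : ℕ → ℕ → ℕ → Set
x ≡ v [mod n ] = ∃[ t ] x ≡ t * n + v

≡[mod]-trans : ∀ {n x y z} → x ≡ y [mod n ] → y ≡ z [mod n ] → x ≡ z [mod n ]
≡[mod]-trans {n} {z = z} (t , refl) (u , refl) = t + u , distrib
  where
  distrib : t * n + (u * n + z) ≡ (t + u) * n + z
  distrib = solve (t ∷ u ∷ n ∷ z ∷ [])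

≡[mod]-+-* : ∀ {n x y u v} → x ≡ u [mod n ] → y ≡ v [mod n ] →
             ∀ m → m * y + x ≡ m * v + u [mod n ]
≡[mod]-+-* {n} {u = u} {v} (t , refl) (s , refl) m = m * s + t , distrib
  where
  distrib : m * (s * n + v) + (t * n + u) ≡ (m * s + t) * n + (m * v + u)
  distrib = solve (m ∷ s ∷ t ∷ n ∷ u ∷ v ∷ [])

NonzeroResidue : ℕ → ℕ → Set
NonzeroResidue n x = ∃[ v ] x ≡ v [mod n ] × 0 < v × v < n

NonzeroResidue-resp : ∀ {n x y} → x ≡ y [mod n ] → NonzeroResidue n y → NonzeroResidue n x
NonzeroResidue-resp x≡y (v , y≡v , 0<v , v<n) = v , ≡[mod]-trans x≡y y≡v , 0<v , v<n

NonzeroResidue⇒∤ : ∀ {n x} → NonzeroResidue n x → ¬ n ∣ x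
NonzeroResidue⇒∤ (suc v , (t , refl) , _ , v<n) n∣x =
  <⇒≱ v<n (∣⇒≤ (∣m+n∣m⇒∣n n∣x (n∣m*n t)))

m*1+0-nonzeroResidue : ∀ {n m} → 0 < m → m < n → NonzeroResidue n (m * 1 + 0)
m*1+0-nonzeroResidue {m = m} 0<m m<n = m , (0 , solve (m ∷ [])) , 0<m , m<n

compositeInfiniteLoop : ∀ {n d} → d ∣ n → 2 ≤ d → d < n → Σ PosReal (λ α → InfiniteLoop n α)
compositeInfiniteLoop {n} {d} d∣n 2≤d d<n = α , loop
  where
  1≤d : 1 ≤ d
  1≤d = ≤-trans (s≤s z≤n) 2≤d

  α : PosReal
  α = rational 1 (λ _ → d) (λ _ _ _ → 1≤d) (λ ()) (λ _ → 2≤d)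

  d∣q₁ : d ∣ d * 1 + 0
  d∣q₁ = divides 1 (solve (d ∷ []))

  loop : InfiniteLoop n α
  loop zero zero _ nonzero _ = contradiction (refl , refl) nonzero
  loop zero (suc m) (inj₁ (_ , m<d)) _ =
    NonzeroResidue⇒∤ (m*1+0-nonzeroResidue (s≤s z≤n) (≤-<-trans m<d d<n))
  loop (suc zero) m (inj₂ refl) _ n∣md+1 =
    <⇒≱ 2≤d (∣⇒≤ (∣m+n∣m⇒∣n (∣-trans d∣n n∣md+1) (∣n⇒∣m*n m d∣q₁)))
  loop (suc zero) _ (inj₁ (s≤s () , _)) _
  loop (suc (suc _)) _ (inj₁ (s≤s () , _)) _
  loop (suc (suc _)) _ (inj₂ ()) _

module AtLeastFive (p : ℕ) where
  n : ℕ
  n = 5 + p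

  laterQuotient : ℕ → ℕ
  laterQuotient zero = 1
  laterQuotient (suc zero) = 1 + p
  laterQuotient (suc (suc k)) = laterQuotient k

  quotient : ℕ → ℕ
  quotient zero = 0
  quotient (suc zero) = 3 + p
  quotient (suc (suc k)) = laterQuotient k

  1≤laterQuotient : ∀ k → 1 ≤ laterQuotient k
  1≤laterQuotient zero = s≤s z≤n
  1≤laterQuotient (suc zero) = s≤s z≤n
  1≤laterQuotient (suc (suc k)) = 1≤laterQuotient k

  1≤quotient : ∀ k → 1 ≤ quotient (suc k)
  1≤quotient zero = s≤s z≤n
  1≤quotient (suc k) = 1≤laterQuotient k

  α : PosReal
  α = irrational quotient 1≤quotient

  -- ρ k is the residue of q_k: 1, −2, −1, 2, 1, −2, …
  ρ : ℕ → ℕ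
  ρ zero = 1
  ρ (suc zero) = 3 + p
  ρ (suc (suc zero)) = 4 + p
  ρ (suc (suc (suc zero))) = 2
  ρ (suc (suc (suc (suc k)))) = ρ k

  ρ-nonzeroResidue : ∀ k → NonzeroResidue n (ρ k)
  ρ-nonzeroResidue zero = 1 , (0 , refl) , s≤s z≤n , s≤s (s≤s z≤n)
  ρ-nonzeroResidue (suc zero) = 3 + p , (0 , refl) , s≤s z≤n , s≤s (s≤s (s≤s (s≤s (n≤1+n p))))
  ρ-nonzeroResidue (suc (suc zero)) = 4 + p , (0 , refl) , s≤s z≤n , ≤-refl
  ρ-nonzeroResidue (suc (suc (suc zero))) = 2 , (0 , refl) , s≤s z≤n , s≤s (s≤s (s≤s z≤n))
  ρ-nonzeroResidue (suc (suc (suc (suc k)))) = ρ-nonzeroResidue k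

  ρ-step : ∀ k → laterQuotient k * ρ (suc k) + ρ k ≡ ρ (suc (suc k)) [mod n ]
  ρ-step zero = 0 , arith
    where arith : 1 * (3 + p) + 1 ≡ 0 * (5 + p) + (4 + p)
          arith = solve (p ∷ [])
  ρ-step (suc zero) = 1 + p , arith
    where arith : (1 + p) * (4 + p) + (3 + p) ≡ (1 + p) * (5 + p) + 2
          arith = solve (p ∷ [])
  ρ-step (suc (suc zero)) = 1 , arith
    where arith : 1 * 2 + (4 + p) ≡ 1 * (5 + p) + 1
          arith = solve (p ∷ [])
  ρ-step (suc (suc (suc zero))) = 0 , arith
    where arith : (1 + p) * 1 + 2 ≡ 0 * (5 + p) + (3 + p)
          arith = solve (p ∷ [])
  ρ-step (suc (suc (suc (suc k)))) = ρ-step k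

  q≡ρ : ∀ k → q α k ≡ ρ k [mod n ]
  q≡ρ zero = 0 , refl
  q≡ρ (suc zero) = 0 , arith
    where arith : (3 + p) * 1 + 0 ≡ 0 * (5 + p) + (3 + p)
          arith = solve (p ∷ [])
  q≡ρ (suc (suc k)) =
    ≡[mod]-trans (≡[mod]-+-* (q≡ρ k) (q≡ρ (suc k)) (laterQuotient k)) (ρ-step k)

  -- m (n − 1) + (n − 2) = m n + (n − 2 − m), with n − 4 = c split as m + d.
  descending : ∀ {m d c} → m + d ≡ c → m * (3 + c) + (2 + c) ≡ m * (4 + c) + (2 + d)
  descending {m} {d} refl = solve (m ∷ d ∷ [])

  semiResidue : ∀ k m → m ≤ laterQuotient k → NonzeroResidue n (m * ρ (suc k) + ρ k)
  semiResidue k zero _ = ρ-nonzeroResidue k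
  semiResidue zero (suc zero) _ = NonzeroResidue-resp (ρ-step zero) (ρ-nonzeroResidue 2)
  semiResidue (suc (suc zero)) (suc zero) _ = NonzeroResidue-resp (ρ-step 2) (ρ-nonzeroResidue 0)
  semiResidue zero (suc (suc _)) (s≤s ())
  semiResidue (suc (suc zero)) (suc (suc _)) (s≤s ())
  semiResidue (suc zero) m m≤1+p with m≤n⇒∃[o]m+o≡n m≤1+p
  ... | d , m+d≡1+p =
    2 + d , (m , descending m+d≡1+p) ,
    s≤s z≤n , s≤s (s≤s (s≤s (m≤n⇒m≤1+n (subst (d ≤_) m+d≡1+p (m≤n+m d m)))))
  semiResidue (suc (suc (suc zero))) m m≤1+p =
    2 + m , (0 , arith) , s≤s z≤n , s≤s (s≤s (s≤s (m≤n⇒m≤1+n m≤1+p)))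
    where arith : m * 1 + 2 ≡ 0 * (5 + p) + (2 + m)
          arith = solve (m ∷ p ∷ [])
  semiResidue (suc (suc (suc (suc k)))) m m≤a = semiResidue k m m≤a

  loop : InfiniteLoop n α
  loop zero zero _ nonzero _ = contradiction (refl , refl) nonzero
  loop zero (suc m) m<3+p _ =
    NonzeroResidue⇒∤ (m*1+0-nonzeroResidue (s≤s z≤n) (s≤s (m≤n⇒m≤1+n m<3+p)))
  loop (suc k) m m≤a _ = NonzeroResidue⇒∤
    (NonzeroResidue-resp (≡[mod]-+-* (q≡ρ k) (q≡ρ (suc k)) m) (semiResidue k m m≤a))

mainTheorem6 : (n : ℕ) → 4 ≤ n → Σ PosReal (λ α → InfiniteLoop n α)
mainTheorem6 zero ()
mainTheorem6 (suc zero) (s≤s ())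
mainTheorem6 (suc (suc zero)) (s≤s (s≤s ()))
mainTheorem6 (suc (suc (suc zero))) (s≤s (s≤s (s≤s ())))
mainTheorem6 (suc (suc (suc (suc zero)))) _ = compositeInfiniteLoop (divides 2 refl) ≤-refl (s≤s (s≤s (s≤s z≤n)))
mainTheorem6 (suc (suc (suc (suc (suc p))))) _ = AtLeastFive.α p , AtLeastFive.loop p
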